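{- The set of automorphisms of $\mathcal{H}$ is exactly $\{h_X:X\in[\omega]^{<\omega}\}$.
   Context: $\mathcal{H}=(H,\{D_i\}_{i<\omega},\{E_i\}_{i<\omega})$ has universe $H=[\omega]^{<\omega}\cup(\omega\times\{0,1\})$, where $[\omega]^{<\omega}$ is the set of finite subsets of $\omega$ (identified with characteristic functions, $X(i)\in\{0,1\}$). $E_i(X,Y)$ holds iff $X,Y\in[\omega]^{<\omega}$ and $X\triangle Y=\{i\}$. $D_i(X,(i,a))$ holds iff $X\in[\omega]^{<\omega}$ and $X(i)=a$; no other instances of these relations hold. For $X\in[\omega]^{<\omega}$, $h_X:H\to H$ is given by $h_X(Y)=X\triangle Y$ for $Y\in[\omega]^{<\omega}$ and $h_X(i,a)=(i,a+X(i)\bmod 2)$. -}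

module Defs where

open import Data.Nat using (ℕ; zero; suc)
open import Data.Bool using (Bool; true; false; _xor_)
open import Data.Product using (_×_; _,_)
open import Data.Sum using (_⊎_; inj₁; inj₂)
open import Data.Empty using (⊥)
open import Relation.Binary.PropositionalEquality using (_≡_)
open import Function.Definitions using (Bijective)
open import Function.Bundles using (_⇔_)

-- Finite subsets of ω, canonically represented by their characteristic
-- bit string (bit 0 first) with no trailing zeros.
-- NE = nonempty bit strings whose last bit is 1.
data NE : Set where
  end : NE                  -- the bit string "1"
  _∷_ : Bool → NE → NE

data FinSet : Set where
  ∅  : FinSet
  ne : NE → FinSet

mem : FinSet → ℕ → Bool
mem ∅ _ = false
mem (ne end) zero = true
mem (ne end) (suc _) = false
mem (ne (b ∷ x)) zero = b
mem (ne (b ∷ x)) (suc i) = mem (ne x) i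

cons : Bool → FinSet → FinSet
cons false ∅ = ∅
cons true ∅ = ne end
cons b (ne x) = ne (b ∷ x)

_△_ : FinSet → FinSet → FinSet
∅ △ Y = Y
ne x △ ∅ = ne x
ne end △ ne end = ∅
ne end △ ne (b ∷ y) = cons (true xor b) (ne y)
ne (a ∷ x) △ ne end = cons (a xor true) (ne x)
ne (a ∷ x) △ ne (b ∷ y) = cons (a xor b) (ne x △ ne y)

singleton : ℕ → FinSet
singleton zero = ne end
singleton (suc i) = cons false (singleton i)

-- universe H = [ω]^{<ω} ∪ (ω × {0,1})   (0,1 rendered as false,true)
H : Set
H = FinSet ⊎ (ℕ × Bool)

E : ℕ → H → H → Set
E i (inj₁ X) (inj₁ Y) = X △ Y ≡ singleton i
E i _ _ = ⊥

D : ℕ → H → H → Set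
D i (inj₁ X) (inj₂ (j , a)) = (j ≡ i) × (mem X i ≡ a)
D i _ _ = ⊥

h : FinSet → H → H
h X (inj₁ Y) = inj₁ (X △ Y)
h X (inj₂ (i , a)) = inj₂ (i , a xor mem X i)

IsAutomorphism : (H → H) → Set
IsAutomorphism f =
  Bijective {A = H} {B = H} _≡_ _≡_ f
  × (∀ i x y → E i x y ⇔ E i (f x) (f y))
  × (∀ i x y → D i x y ⇔ D i (f x) (f y))

-- The finite sets, with the relations E_i, form the hypercube whose edges are coloured by
-- the coordinate they flip, and D_i reads off coordinate i.  An endomorphism f must send
-- sets to sets (a set is exactly something in a D_0-relation), and the induced map F on
-- sets sends every i-edge to an i-edge, i.e. F (s_i △ Z) = F Z △ s_i.  Since every finite
-- set is reached from ∅ by toggling singletons, F Y = F ∅ △ Y.  Finally D_i pins down the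
-- image of (i , a) as (i , a + X(i)) with X = F ∅, so f = h_X.  Conversely, each h_X is an
-- involution that commutes with △ in the way E_i and D_i require.
module Submission where

open import Defs
open import Data.Product using (∃)
open import Relation.Binary.PropositionalEquality using (_≡_)
open import Function.Bundles using (_⇔_)

open import Data.Nat using (zero; suc)
open import Data.Bool using (true; false; _xor_)
open import Data.Bool.Properties using (xor-assoc; xor-comm; xor-same; xor-identityʳ)
open import Data.Product using (_×_; _,_; proj₁; proj₂)
open import Data.Sum using (inj₁; inj₂)
open import Data.Sum.Properties using (inj₁-injective)
open import Function using (_∘_)
open import Function.Bundles using (mk⇔; Equivalence)
open import Function.Consequences.Propositional
  using (inverseᵇ⇒bijective; strictlyInverseˡ⇒inverseˡ; strictlyInverseʳ⇒inverseʳ)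
open import Relation.Binary.PropositionalEquality
  using (_≗_; refl; sym; trans; cong; cong₂; subst; subst₂; module ≡-Reasoning)

open ≡-Reasoning

xor-cancelʳ : ∀ a c → (a xor c) xor c ≡ a
xor-cancelʳ a c = begin
  (a xor c) xor c  ≡⟨ xor-assoc a c c ⟩
  a xor (c xor c)  ≡⟨ cong (a xor_) (xor-same c) ⟩
  a xor false      ≡⟨ xor-identityʳ a ⟩
  a                ∎

mem-cons-zero : ∀ b Z → mem (cons b Z) zero ≡ b
mem-cons-zero false ∅      = refl
mem-cons-zero true  ∅      = refl
mem-cons-zero false (ne x) = refl
mem-cons-zero true  (ne x) = refl

mem-cons-suc : ∀ b Z k → mem (cons b Z) (suc k) ≡ mem Z k
mem-cons-suc false ∅      k = refl
mem-cons-suc true  ∅      k = refl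
mem-cons-suc false (ne x) k = refl
mem-cons-suc true  (ne x) k = refl

mem-singleton : ∀ i → mem (singleton i) i ≡ true
mem-singleton zero    = refl
mem-singleton (suc i) = trans (mem-cons-suc false (singleton i) i) (mem-singleton i)

mem-△ : ∀ X Y k → mem (X △ Y) k ≡ mem X k xor mem Y k
mem-△ ∅                 Y                 k       = refl
mem-△ (ne x)            ∅                 k       = sym (xor-identityʳ (mem (ne x) k))
mem-△ (ne end)          (ne end)          zero    = refl
mem-△ (ne end)          (ne end)          (suc k) = refl
mem-△ (ne end)          (ne (b ∷ y))      zero    = mem-cons-zero (true xor b) (ne y)
mem-△ (ne end)          (ne (b ∷ y))      (suc k) = mem-cons-suc (true xor b) (ne y) k
mem-△ (ne (a ∷ x))      (ne end)          zero    = mem-cons-zero (a xor true) (ne x)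
mem-△ (ne (a ∷ x))      (ne end)          (suc k) =
  trans (mem-cons-suc (a xor true) (ne x) k) (sym (xor-identityʳ (mem (ne x) k)))
mem-△ (ne (a ∷ x))      (ne (b ∷ y))      zero    = mem-cons-zero (a xor b) (ne x △ ne y)
mem-△ (ne (a ∷ x))      (ne (b ∷ y))      (suc k) =
  trans (mem-cons-suc (a xor b) (ne x △ ne y) k) (mem-△ (ne x) (ne y) k)

-- Injectivity of mem rests on the canonical form: a nonempty bit string ends in a 1.
ne-has-member : ∀ x → ∃ λ k → mem (ne x) k ≡ true
ne-has-member end         = zero , refl
ne-has-member (true ∷ x)  = zero , refl
ne-has-member (false ∷ x) with ne-has-member x
... | k , p = suc k , p

ne-injective-mem : ∀ x y → mem (ne x) ≗ mem (ne y) → x ≡ y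
ne-injective-mem end         end         e = refl
ne-injective-mem end         (false ∷ y) e with e zero
... | ()
ne-injective-mem end         (true ∷ y)  e with ne-has-member y
... | k , p with trans (e (suc k)) p
...   | ()
ne-injective-mem (false ∷ x) end         e with e zero
... | ()
ne-injective-mem (true ∷ x)  end         e with ne-has-member x
... | k , p with trans (sym (e (suc k))) p
...   | ()
ne-injective-mem (a ∷ x)     (b ∷ y)     e with e zero
... | refl = cong (a ∷_) (ne-injective-mem x y (e ∘ suc))

mem-injective : ∀ X Y → mem X ≗ mem Y → X ≡ Y
mem-injective ∅      ∅      e = refl
mem-injective ∅      (ne y) e with ne-has-member y
... | k , p with trans (e k) p
...   | ()
mem-injective (ne x) ∅      e with ne-has-member x
... | k , p with trans (sym (e k)) p
...   | ()
mem-injective (ne x) (ne y) e = cong ne (ne-injective-mem x y e)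

△-identityʳ : ∀ X → X △ ∅ ≡ X
△-identityʳ X = mem-injective _ _ λ k → trans (mem-△ X ∅ k) (xor-identityʳ (mem X k))

△-comm : ∀ X Y → X △ Y ≡ Y △ X
△-comm X Y = mem-injective _ _ λ k → begin
  mem (X △ Y) k        ≡⟨ mem-△ X Y k ⟩
  mem X k xor mem Y k  ≡⟨ xor-comm (mem X k) (mem Y k) ⟩
  mem Y k xor mem X k  ≡⟨ mem-△ Y X k ⟨
  mem (Y △ X) k        ∎

△-assoc : ∀ X Y Z → (X △ Y) △ Z ≡ X △ (Y △ Z)
△-assoc X Y Z = mem-injective _ _ λ k → begin
  mem ((X △ Y) △ Z) k                ≡⟨ mem-△ (X △ Y) Z k ⟩
  mem (X △ Y) k xor mem Z k          ≡⟨ cong (_xor mem Z k) (mem-△ X Y k) ⟩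
  (mem X k xor mem Y k) xor mem Z k  ≡⟨ xor-assoc (mem X k) (mem Y k) (mem Z k) ⟩
  mem X k xor (mem Y k xor mem Z k)  ≡⟨ cong (mem X k xor_) (mem-△ Y Z k) ⟨
  mem X k xor mem (Y △ Z) k          ≡⟨ mem-△ X (Y △ Z) k ⟨
  mem (X △ (Y △ Z)) k                ∎

△-self : ∀ X → X △ X ≡ ∅
△-self X = mem-injective _ _ λ k → trans (mem-△ X X k) (xor-same (mem X k))

△-cancelˡ : ∀ X Y → X △ (X △ Y) ≡ Y
△-cancelˡ X Y = begin
  X △ (X △ Y)  ≡⟨ △-assoc X X Y ⟨
  (X △ X) △ Y  ≡⟨ cong (_△ Y) (△-self X) ⟩
  Y            ∎

△-translate : ∀ X Y Z → (X △ Y) △ (X △ Z) ≡ Y △ Z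
△-translate X Y Z = begin
  (X △ Y) △ (X △ Z)  ≡⟨ cong (_△ (X △ Z)) (△-comm X Y) ⟩
  (Y △ X) △ (X △ Z)  ≡⟨ △-assoc Y X (X △ Z) ⟩
  Y △ (X △ (X △ Z))  ≡⟨ cong (Y △_) (△-cancelˡ X Z) ⟩
  Y △ Z              ∎

cons-△-singleton : ∀ b i Z → cons b (singleton i △ Z) ≡ singleton (suc i) △ cons b Z
cons-△-singleton b i Z = mem-injective _ _ λ where
  zero → begin
    mem (cons b (singleton i △ Z)) zero                   ≡⟨ mem-cons-zero b _ ⟩
    b                                                     ≡⟨ mem-cons-zero b Z ⟨
    mem (cons b Z) zero
      ≡⟨ cong (_xor mem (cons b Z) zero) (mem-cons-zero false (singleton i)) ⟨
    mem (singleton (suc i)) zero xor mem (cons b Z) zero  ≡⟨ mem-△ (singleton (suc i)) (cons b Z) zero ⟨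
    mem (singleton (suc i) △ cons b Z) zero               ∎
  (suc k) → begin
    mem (cons b (singleton i △ Z)) (suc k)  ≡⟨ mem-cons-suc b _ k ⟩
    mem (singleton i △ Z) k                 ≡⟨ mem-△ (singleton i) Z k ⟩
    mem (singleton i) k xor mem Z k
      ≡⟨ cong₂ _xor_ (mem-cons-suc false (singleton i) k) (mem-cons-suc b Z k) ⟨
    mem (singleton (suc i)) (suc k) xor mem (cons b Z) (suc k)
      ≡⟨ mem-△ (singleton (suc i)) (cons b Z) (suc k) ⟨
    mem (singleton (suc i) △ cons b Z) (suc k)  ∎

cons-ne : ∀ b x → cons b (ne x) ≡ ne (b ∷ x)
cons-ne false x = refl
cons-ne true  x = refl

-- The recursion shifts the motive along cons b, which commutes with toggling singletons.
singleton-induction : (P : FinSet → Set) → P ∅ → (∀ i Z → P Z → P (singleton i △ Z)) →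
                      ∀ Y → P Y
singleton-induction P base step ∅            = base
singleton-induction P base step (ne end)     = step zero ∅ base
singleton-induction P base step (ne (b ∷ x)) =
  subst P (cons-ne b x) (singleton-induction (P ∘ cons b) (base-cons b) step-cons (ne x))
  where
  base-cons : ∀ c → P (cons c ∅)
  base-cons false = base
  base-cons true  = step zero ∅ base
  step-cons : ∀ i Z → P (cons b Z) → P (cons b (singleton i △ Z))
  step-cons i Z p = subst P (sym (cons-△-singleton b i Z)) (step (suc i) (cons b Z) p)

PreservesEdgeColours : (FinSet → FinSet) → Set
PreservesEdgeColours F = ∀ i Z → F Z △ F (singleton i △ Z) ≡ singleton i

preservesEdgeColours⇒translation : ∀ {F} → PreservesEdgeColours F → ∀ Y → F Y ≡ F ∅ △ Y
preservesEdgeColours⇒translation {F} edge =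
  singleton-induction (λ Y → F Y ≡ F ∅ △ Y) (sym (△-identityʳ (F ∅))) step
  where
  step : ∀ i Z → F Z ≡ F ∅ △ Z → F (singleton i △ Z) ≡ F ∅ △ (singleton i △ Z)
  step i Z ih = begin
    F (singleton i △ Z)                ≡⟨ △-cancelˡ (F Z) (F (singleton i △ Z)) ⟨
    F Z △ (F Z △ F (singleton i △ Z))  ≡⟨ cong (F Z △_) (edge i Z) ⟩
    F Z △ singleton i                  ≡⟨ cong (_△ singleton i) ih ⟩
    (F ∅ △ Z) △ singleton i            ≡⟨ △-assoc (F ∅) Z (singleton i) ⟩
    F ∅ △ (Z △ singleton i)            ≡⟨ cong (F ∅ △_) (△-comm Z (singleton i)) ⟩
    F ∅ △ (singleton i △ Z)            ∎

∃-mem≡ : ∀ i a → ∃ λ Y → mem Y i ≡ a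
∃-mem≡ i false = ∅ , refl
∃-mem≡ i true  = singleton i , mem-singleton i

IsHomomorphism : (H → H) → Set
IsHomomorphism f = (∀ i x y → E i x y → E i (f x) (f y))
                 × (∀ i x y → D i x y → D i (f x) (f y))

isAutomorphism⇒isHomomorphism : ∀ {f} → IsAutomorphism f → IsHomomorphism f
isAutomorphism⇒isHomomorphism (_ , preservesE , preservesD) =
  (λ i x y → Equivalence.to (preservesE i x y)) , (λ i x y → Equivalence.to (preservesD i x y))

module _ {f : H → H} (hom : IsHomomorphism f) where

  private
    preservesE = proj₁ hom
    preservesD = proj₂ hom

  D-image : ∀ i Y → ∃ λ Y′ → f (inj₁ Y) ≡ inj₁ Y′ × f (inj₂ (i , mem Y i)) ≡ inj₂ (i , mem Y′ i)
  D-image i Y with f (inj₁ Y) | f (inj₂ (i , mem Y i)) | preservesD i (inj₁ Y) (inj₂ (i , mem Y i)) (refl , refl)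
  ... | inj₁ Y′ | inj₂ (.i , a) | refl , Y′ᵢ≡a = Y′ , refl , cong (λ b → inj₂ (i , b)) (sym Y′ᵢ≡a)

  setPart : FinSet → FinSet
  setPart Y = proj₁ (D-image zero Y)

  f-inj₁ : ∀ Y → f (inj₁ Y) ≡ inj₁ (setPart Y)
  f-inj₁ Y = proj₁ (proj₂ (D-image zero Y))

  f-inj₂ : ∀ i Y → f (inj₂ (i , mem Y i)) ≡ inj₂ (i , mem (setPart Y) i)
  f-inj₂ i Y with D-image i Y
  ... | Y′ , fY≡Y′ , fYᵢ≡Y′ᵢ
    rewrite inj₁-injective (trans (sym fY≡Y′) (f-inj₁ Y)) = fYᵢ≡Y′ᵢ

  setPart-preservesEdgeColours : PreservesEdgeColours setPart
  setPart-preservesEdgeColours i Z =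
    subst₂ (E i) (f-inj₁ Z) (f-inj₁ (singleton i △ Z))
      (preservesE i (inj₁ Z) (inj₁ (singleton i △ Z)) (Z△sᵢ△Z≡sᵢ))
    where
    Z△sᵢ△Z≡sᵢ : Z △ (singleton i △ Z) ≡ singleton i
    Z△sᵢ△Z≡sᵢ = trans (cong (Z △_) (△-comm (singleton i) Z)) (△-cancelˡ Z (singleton i))

  setPart-translation : ∀ Y → setPart Y ≡ setPart ∅ △ Y
  setPart-translation = preservesEdgeColours⇒translation {setPart} setPart-preservesEdgeColours

  isHomomorphism⇒≗h : f ≗ h (setPart ∅)
  isHomomorphism⇒≗h (inj₁ Y) = trans (f-inj₁ Y) (cong inj₁ (setPart-translation Y))
  isHomomorphism⇒≗h (inj₂ (i , a)) with ∃-mem≡ i a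
  ... | Y , refl = begin
    f (inj₂ (i , mem Y i))          ≡⟨ f-inj₂ i Y ⟩
    inj₂ (i , mem (setPart Y) i)    ≡⟨ cong (λ Z → inj₂ (i , mem Z i)) (setPart-translation Y) ⟩
    inj₂ (i , mem (X △ Y) i)        ≡⟨ cong (λ b → inj₂ (i , b)) (mem-△ X Y i) ⟩
    inj₂ (i , mem X i xor mem Y i)  ≡⟨ cong (λ b → inj₂ (i , b)) (xor-comm (mem X i) (mem Y i)) ⟩
    inj₂ (i , mem Y i xor mem X i)  ∎
    where
    X = setPart ∅

h-involutive : ∀ X y → h X (h X y) ≡ y
h-involutive X (inj₁ Y)       = cong inj₁ (△-cancelˡ X Y)
h-involutive X (inj₂ (i , a)) = cong (λ b → inj₂ (i , b)) (xor-cancelʳ a (mem X i))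

h-preserves-E : ∀ X i x y → E i x y ⇔ E i (h X x) (h X y)
h-preserves-E X i (inj₁ x) (inj₁ y) = mk⇔ (trans (△-translate X x y)) (trans (sym (△-translate X x y)))
h-preserves-E X i (inj₁ x) (inj₂ y) = mk⇔ (λ ()) (λ ())
h-preserves-E X i (inj₂ x) y        = mk⇔ (λ ()) (λ ())

h-preserves-D : ∀ X i x y → D i x y ⇔ D i (h X x) (h X y)
h-preserves-D X i (inj₁ Y) (inj₂ (j , a)) = mk⇔ to from
  where
  to : D i (inj₁ Y) (inj₂ (j , a)) → D i (h X (inj₁ Y)) (h X (inj₂ (j , a)))
  to (refl , Yᵢ≡a) = refl , (begin
    mem (X △ Y) i          ≡⟨ mem-△ X Y i ⟩
    mem X i xor mem Y i    ≡⟨ xor-comm (mem X i) (mem Y i) ⟩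
    mem Y i xor mem X i    ≡⟨ cong (_xor mem X i) Yᵢ≡a ⟩
    a xor mem X i          ∎)
  from : D i (h X (inj₁ Y)) (h X (inj₂ (j , a))) → D i (inj₁ Y) (inj₂ (j , a))
  from (refl , [X△Y]ᵢ≡a+Xᵢ) = refl , (begin
    mem Y i                            ≡⟨ xor-cancelʳ (mem Y i) (mem X i) ⟨
    (mem Y i xor mem X i) xor mem X i  ≡⟨ cong (_xor mem X i) (xor-comm (mem Y i) (mem X i)) ⟩
    (mem X i xor mem Y i) xor mem X i  ≡⟨ cong (_xor mem X i) (mem-△ X Y i) ⟨
    mem (X △ Y) i xor mem X i          ≡⟨ cong (_xor mem X i) [X△Y]ᵢ≡a+Xᵢ ⟩
    (a xor mem X i) xor mem X i        ≡⟨ xor-cancelʳ a (mem X i) ⟩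
    a                                  ∎)
h-preserves-D X i (inj₁ x) (inj₁ y) = mk⇔ (λ ()) (λ ())
h-preserves-D X i (inj₂ x) y        = mk⇔ (λ ()) (λ ())

≗h⇒isAutomorphism : ∀ {f X} → f ≗ h X → IsAutomorphism f
≗h⇒isAutomorphism {f} {X} f≗hX =
  inverseᵇ⇒bijective (strictlyInverseˡ⇒inverseˡ f inverseˡ , strictlyInverseʳ⇒inverseʳ f inverseʳ) ,
  (λ i → transport (h-preserves-E X i)) ,
  (λ i → transport (h-preserves-D X i))
  where
  inverseˡ : ∀ y → f (h X y) ≡ y
  inverseˡ y = trans (f≗hX (h X y)) (h-involutive X y)
  inverseʳ : ∀ x → h X (f x) ≡ x
  inverseʳ x = trans (cong (h X) (f≗hX x)) (h-involutive X x)
  transport : ∀ {R : H → H → Set} → (∀ x y → R x y ⇔ R (h X x) (h X y)) → ∀ x y → R x y ⇔ R (f x) (f y)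
  transport {R} hR x y = subst₂ (λ u v → R x y ⇔ R u v) (sym (f≗hX x)) (sym (f≗hX y)) (hR x y)

corollary3p8 : (f : H → H) →
    IsAutomorphism f ⇔ ∃ (λ X → ∀ y → f y ≡ h X y)
corollary3p8 f = mk⇔ automorphism⇒translation (λ (X , f≗hX) → ≗h⇒isAutomorphism f≗hX)
  where
  automorphism⇒translation : IsAutomorphism f → ∃ λ X → f ≗ h X
  automorphism⇒translation aut = setPart hom ∅ , isHomomorphism⇒≗h hom
    where hom = isAutomorphism⇒isHomomorphism aut
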